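{- Let $G=(S,T;E)$, $S=\{s_1,\dots,s_n\}$, $d\in\mathbb Z_+$ and $w:E\to\mathbb R_+$. Suppose $s\in S$ satisfies $\deg(s)\ge 2d$, and let $st$ be an arbitrary minimum-weight edge among the edges incident to $s$. Then the maximum weight of a perfect $d$-distance matching in $G$ equals the maximum weight of a perfect $d$-distance matching in $G-st$ (the graph obtained by deleting the edge $st$).
   Context: $G=(S,T;E)$ is a finite bipartite graph without loops or parallel edges, with the nodes of $S$ in a fixed linear order $s_1,\dots,s_n$. A $d$-distance matching is a subset $M\subseteq E$ such that every node of $S$ is incident to at most one edge of $M$, and whenever $s_it,s_jt\in M$ with $i\ne j$, $t\in T$, we have $|j-i|\ge d$; it is perfect if every node of $S$ is incident to exactly one edge of $M$. The weight of $M$ is $w(M)=\sum_{e\in M}w(e)$.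
   Formalization: The edge weights are nonnegative rationals instead of nonnegative reals. -}

module Defs where

open import Data.Nat using (ℕ; _≤_; ∣_-_∣)
open import Data.Fin using (Fin; toℕ; _≟_)
open import Data.Bool using (Bool; true; false; _∧_; if_then_else_)
open import Data.List using (List; length; filterᵇ; foldr; map; allFin)
open import Data.Rational using (ℚ; 0ℚ; _+_) renaming (_≤_ to _≤ℚ_)
open import Data.Product using (Σ; _×_; _,_)
open import Relation.Binary.PropositionalEquality using (_≡_; _≢_)
open import Relation.Nullary.Decidable using (⌊_⌋)

-- A bipartite graph G = (S, T; E) with S = {s_0,...,s_{n-1}} (in this linear
-- order, via Fin n) and T = Fin m, with no parallel edges: the edge set is a
-- Boolean adjacency relation.
Graph : ℕ → ℕ → Set
Graph n m = Fin n → Fin m → Bool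

-- weights on pairs (only values on edges matter)
Weight : ℕ → ℕ → Set
Weight n m = Fin n → Fin m → ℚ

NonNegW : ∀ {n m} → Graph n m → Weight n m → Set
NonNegW {n} {m} E w = (i : Fin n) (t : Fin m) → E i t ≡ true → 0ℚ ≤ℚ w i t

deg : ∀ {n m} → Graph n m → Fin n → ℕ
deg {n} {m} E s = length (filterᵇ (E s) (allFin m))

deleteEdge : ∀ {n m} → Graph n m → Fin n → Fin m → Graph n m
deleteEdge E s t i u = if (⌊ i ≟ s ⌋ ∧ ⌊ u ≟ t ⌋) then false else E i u

-- A perfect matching (set of edges covering every node of S exactly once)
-- is encoded as the function assigning to each s_i its unique partner.
Assignment : ℕ → ℕ → Set
Assignment n m = Fin n → Fin m

IsPerfectDMatching : ∀ {n m} → Graph n m → ℕ → Assignment n m → Set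
IsPerfectDMatching {n} E d M =
  ((i : Fin n) → E i (M i) ≡ true) ×
  ((i j : Fin n) → i ≢ j → M i ≡ M j → d ≤ ∣ toℕ i - toℕ j ∣)

weightOf : ∀ {n m} → Weight n m → Assignment n m → ℚ
weightOf {n} w M = foldr _+_ 0ℚ (map (λ i → w i (M i)) (allFin n))

IsMaxPerfectDWeight : ∀ {n m} → Graph n m → ℕ → Weight n m → ℚ → Set
IsMaxPerfectDWeight {n} {m} E d w v =
  Σ (Assignment n m) (λ M → IsPerfectDMatching E d M × weightOf w M ≡ v) ×
  ((M : Assignment n m) → IsPerfectDMatching E d M → weightOf w M ≤ℚ v)

IsMinEdgeAt : ∀ {n m} → Graph n m → Weight n m → Fin n → Fin m → Set
IsMinEdgeAt {n} {m} E w s t =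
  (E s t ≡ true) × ((u : Fin m) → E s u ≡ true → w s t ≤ℚ w s u)

{-# OPTIONS --safe #-}

-- If a perfect d-distance matching M uses the edge st, move s to another neighbour u.
-- At most 2d − 1 nodes of S (s among them) lie at distance less than d from s, so
-- as deg s ≥ 2d some neighbour u is the partner of none of them; reassigning s to u
-- keeps the matching d-distant, avoids st, and cannot lose weight because st is a
-- lightest edge at s. Hence the perfect d-distance matchings avoiding st dominate all
-- of them, and both families have the same maximum weight.

module Submission where

open import Defs
open import Data.Bool using (true; T?)
open import Data.Bool.Properties using (T-≡)
open import Data.Fin using (Fin; toℕ; _≟_)
open import Data.Fin.Properties using (toℕ-injective)
open import Data.List using (List; []; _∷_; length; map; foldr; filter; allFin; applyUpTo)
open import Data.List.Properties using (filter-notAll; length-map; length-applyUpTo)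
open import Data.List.Membership.Propositional using (_∈_; _∉_; find)
open import Data.List.Membership.Propositional.Properties
  using (∈-filter⁺; ∈-filter⁻; ∈-map⁺; ∈-map⁻; ∈-applyUpTo⁺; ∈-allFin)
open import Data.List.Relation.Binary.Subset.Propositional using (_⊆_)
open import Data.List.Relation.Unary.All as All using (all?)
open import Data.List.Relation.Unary.All.Properties using (¬All⇒Any¬)
open import Data.List.Relation.Unary.Any as Any using (here; there)
open import Data.List.Relation.Unary.AllPairs using (_∷_)
open import Data.List.Relation.Unary.Unique.Propositional using (Unique)
open import Data.List.Relation.Unary.Unique.Propositional.Properties using (allFin⁺; filter⁺; map⁺)
open import Data.Nat as ℕ using (ℕ; suc; _+_; _∸_; _*_; _≤_; _<_; _≥_; ∣_-_∣; z≤n; s≤s; _≤?_)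
open import Data.Nat.Properties
  using (≤-trans; ≤-reflexive; <⇒≱; ≰⇒>; +-comm; +-assoc; +-monoʳ-≤; +-monoˡ-≤; +-suc; n<1+n;
         +-identityʳ; ∣-∣-comm; ∣n-n∣≡0; m≤n+∣n-m∣; m≤n+∣m-n∣; m≤n+m∸n; m≤n+o⇒m∸n≤o; m+[n∸m]≡n;
         module ≤-Reasoning)
open import Data.Product using (∃; _×_; _,_; proj₁; proj₂)
open import Data.Rational using (ℚ; 0ℚ) renaming (_+_ to _+ℚ_; _≤_ to _≤ℚ_)
import Data.Rational.Properties as ℚ
open import Data.Vec.Functional using (updateAt)
open import Data.Vec.Functional.Properties using (updateAt-updates; updateAt-minimal)
open import Function using (_∘_; const)
open import Function.Bundles using (_⇔_; mk⇔; Equivalence)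
open import Relation.Binary.Definitions using (DecidableEquality)
open import Relation.Binary.PropositionalEquality using (_≡_; _≢_; refl; sym; trans; cong; subst; subst₂)
open import Relation.Nullary using (¬?; yes; no; contradiction)

module _ {a} {A : Set a} (_≟ᴬ_ : DecidableEquality A) where

  open import Data.List.Membership.DecPropositional _≟ᴬ_ using (_∈?_)

  unique-⊆⇒length≤ : {xs ys : List A} → Unique xs → xs ⊆ ys → length xs ≤ length ys
  unique-⊆⇒length≤ {[]} _ _ = z≤n
  unique-⊆⇒length≤ {x ∷ xs} {ys} (x≢xs ∷ xs-unique) xs⊆ys =
    ≤-trans (s≤s (unique-⊆⇒length≤ xs-unique xs⊆ys-x))
            (filter-notAll P? ys (Any.map (λ x≡y x≢y → x≢y x≡y) (xs⊆ys (here refl))))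
    where
    P? = λ y → ¬? (x ≟ᴬ y)
    xs⊆ys-x : xs ⊆ filter P? ys
    xs⊆ys-x z∈xs = ∈-filter⁺ P? (xs⊆ys (there z∈xs)) (All.lookup x≢xs z∈xs)

  unique-longer⇒∉ : {xs ys : List A} → Unique xs → length ys < length xs →
                    ∃ λ x → x ∈ xs × x ∉ ys
  unique-longer⇒∉ {xs} {ys} xs-unique ys<xs with all? (_∈? ys) xs
  ... | yes xs⊆ys = contradiction (unique-⊆⇒length≤ xs-unique (All.lookup xs⊆ys)) (<⇒≱ ys<xs)
  ... | no xs⊈ys = find (¬All⇒Any¬ (_∈? ys) xs xs⊈ys)

-- Truncated subtraction: for a < r the window starts at 0 rather than at a − r.
window : ℕ → ℕ → List ℕ
window a r = applyUpTo ((a ∸ r) +_) (r + suc r)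

∈-window : ∀ {a r b} → ∣ b - a ∣ ≤ r → b ∈ window a r
∈-window {a} {r} {b} ∣b-a∣≤r = subst (_∈ window a r) (m+[n∸m]≡n lo≤b) (∈-applyUpTo⁺ _ offset<)
  where
  open ≤-Reasoning
  lo = a ∸ r
  lo≤b : lo ≤ b
  lo≤b = m≤n+o⇒m∸n≤o a r (begin
    a               ≤⟨ m≤n+∣n-m∣ a b ⟩
    b + ∣ b - a ∣   ≤⟨ +-monoʳ-≤ b ∣b-a∣≤r ⟩
    b + r           ≡⟨ +-comm b r ⟩
    r + b           ∎)
  offset< : b ∸ lo < r + suc r
  offset< = ≤-trans (s≤s (m≤n+o⇒m∸n≤o b lo (begin
    b               ≤⟨ m≤n+∣m-n∣ b a ⟩
    a + ∣ b - a ∣   ≤⟨ +-monoʳ-≤ a ∣b-a∣≤r ⟩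
    a + r           ≤⟨ +-monoˡ-≤ r (m≤n+m∸n a r) ⟩
    r + lo + r      ≡⟨ cong (_+ r) (+-comm r lo) ⟩
    lo + r + r      ≡⟨ +-assoc lo r r ⟩
    lo + (r + r)    ∎)))
    (≤-reflexive (sym (+-suc r r)))

near : ∀ {n} → Fin n → ℕ → List (Fin n)
near {n} s r = filter (λ j → ∣ toℕ j - toℕ s ∣ ≤? r) (allFin n)

∈-near⁺ : ∀ {n} {s j : Fin n} {r} → ∣ toℕ j - toℕ s ∣ ≤ r → j ∈ near s r
∈-near⁺ {s = s} {j} {r} = ∈-filter⁺ (λ j → ∣ toℕ j - toℕ s ∣ ≤? r) (∈-allFin j)

∈-near⁻ : ∀ {n} {s j : Fin n} {r} → j ∈ near s r → ∣ toℕ j - toℕ s ∣ ≤ r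
∈-near⁻ {n} {s} {r = r} = proj₂ ∘ ∈-filter⁻ (λ j → ∣ toℕ j - toℕ s ∣ ≤? r) {xs = allFin n}

self∈near : ∀ {n} (s : Fin n) r → s ∈ near s r
self∈near s r = ∈-near⁺ (subst (_≤ r) (sym (∣n-n∣≡0 (toℕ s))) z≤n)

length-near≤ : ∀ {n} (s : Fin n) r → length (near s r) ≤ r + suc r
length-near≤ {n} s r = begin
  length (near s r)              ≡⟨ length-map toℕ (near s r) ⟨
  length (map toℕ (near s r))    ≤⟨ unique-⊆⇒length≤ ℕ._≟_ near-unique near⊆window ⟩
  length (window (toℕ s) r)      ≡⟨ length-applyUpTo _ (r + suc r) ⟩
  r + suc r                      ∎
  where
  open ≤-Reasoning
  near-unique : Unique (map toℕ (near s r))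
  near-unique = map⁺ toℕ-injective (filter⁺ _ (allFin⁺ n))
  near⊆window : map toℕ (near s r) ⊆ window (toℕ s) r
  near⊆window b∈ with j , j∈near , refl ← ∈-map⁻ toℕ b∈ = ∈-window (∈-near⁻ j∈near)

free-neighbour : ∀ {n m} (E : Graph n m) s (B : List (Fin m)) → length B < deg E s →
                 ∃ λ u → E s u ≡ true × u ∉ B
free-neighbour {m = m} E s B B<deg
  with u , u∈nbrs , u∉B ← unique-longer⇒∉ _≟_ (filter⁺ (T? ∘ E s) (allFin⁺ m)) B<deg =
  u , Equivalence.to T-≡ (proj₂ (∈-filter⁻ (T? ∘ E s) {xs = allFin m} u∈nbrs)) , u∉B

sum-mono-≤ : ∀ {a} {A : Set a} {f g : A → ℚ} → (∀ x → f x ≤ℚ g x) →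
             ∀ xs → foldr _+ℚ_ 0ℚ (map f xs) ≤ℚ foldr _+ℚ_ 0ℚ (map g xs)
sum-mono-≤ f≤g []       = ℚ.≤-refl
sum-mono-≤ f≤g (x ∷ xs) = ℚ.+-mono-≤ (f≤g x) (sum-mono-≤ f≤g xs)

weightOf-mono-≤ : ∀ {n m} (w : Weight n m) {M M′ : Assignment n m} →
                  (∀ i → w i (M i) ≤ℚ w i (M′ i)) → weightOf w M ≤ℚ weightOf w M′
weightOf-mono-≤ {n} w le = sum-mono-≤ le (allFin n)

module _ {n m} (E : Graph n m) where

  module _ {r} {M : Assignment n m} (M-perfect : IsPerfectDMatching E (suc r) M)
           {s u} (su∈E : E s u ≡ true) (u-free : u ∉ map M (near s r)) where

    private
      M′ = updateAt M s (const u)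

      M′-s : M′ s ≡ u
      M′-s = updateAt-updates s M

      M′-other : ∀ i → i ≢ s → M′ i ≡ M i
      M′-other i i≢s = updateAt-minimal i s M i≢s

      far : ∀ j → M j ≡ u → suc r ≤ ∣ toℕ j - toℕ s ∣
      far j Mj≡u with ∣ toℕ j - toℕ s ∣ ≤? r
      ... | yes j∈near = contradiction (subst (_∈ map M (near s r)) Mj≡u
                           (∈-map⁺ M (∈-near⁺ j∈near)))
                           u-free
      ... | no j∉near = ≰⇒> j∉near

    updateAt-isPerfect : IsPerfectDMatching E (suc r) (updateAt M s (const u))
    updateAt-isPerfect = edges , distant
      where
      edges : ∀ i → E i (M′ i) ≡ true
      edges i with i ≟ s
      ... | yes refl = subst (λ v → E s v ≡ true) (sym M′-s) su∈E
      ... | no i≢s   = subst (λ v → E i v ≡ true) (sym (M′-other i i≢s)) (proj₁ M-perfect i)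
      distant : ∀ i j → i ≢ j → M′ i ≡ M′ j → suc r ≤ ∣ toℕ i - toℕ j ∣
      distant i j i≢j M′i≡M′j with i ≟ s | j ≟ s
      ... | yes refl | yes refl = contradiction refl i≢j
      ... | yes refl | no j≢s   = subst (suc r ≤_) (∣-∣-comm (toℕ j) (toℕ s))
            (far j (trans (sym (M′-other j j≢s)) (trans (sym M′i≡M′j) M′-s)))
      ... | no i≢s   | yes refl = far i (trans (sym (M′-other i i≢s)) (trans M′i≡M′j M′-s))
      ... | no i≢s   | no j≢s   = proj₂ M-perfect i j i≢j
            (trans (sym (M′-other i i≢s)) (trans M′i≡M′j (M′-other j j≢s)))

  reroute : ∀ {r} (w : Weight n m) {s t} → IsMinEdgeAt E w s t → deg E s ≥ 2 * suc r →
            ∀ {M} → IsPerfectDMatching E (suc r) M → M s ≡ t →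
            ∃ λ M′ → IsPerfectDMatching E (suc r) M′ × M′ s ≢ t × weightOf w M ≤ℚ weightOf w M′
  reroute {r} w {s} {t} (_ , t-lightest) deg≥ {M} M-perfect Ms≡t =
    let u , su∈E , u-free = free-neighbour E s (map M (near s r)) blocked<deg
    in  updateAt M s (const u) , updateAt-isPerfect M-perfect su∈E u-free ,
        avoids-t u u-free , weightOf-mono-≤ w (heavier u su∈E)
    where
    open ≤-Reasoning
    blocked<deg : length (map M (near s r)) < deg E s
    blocked<deg = begin-strict
      length (map M (near s r)) ≡⟨ length-map M (near s r) ⟩
      length (near s r)         ≤⟨ length-near≤ s r ⟩
      r + suc r                 <⟨ n<1+n (r + suc r) ⟩
      suc r + suc r             ≡⟨ cong (suc r +_) (+-identityʳ (suc r)) ⟨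
      2 * suc r                 ≤⟨ deg≥ ⟩
      deg E s                   ∎
    t-blocked : t ∈ map M (near s r)
    t-blocked = subst (_∈ map M (near s r)) Ms≡t (∈-map⁺ M (self∈near s r))
    avoids-t : ∀ u → u ∉ map M (near s r) → updateAt M s (const u) s ≢ t
    avoids-t u u-free M′s≡t =
      u-free (subst (_∈ map M (near s r)) (sym (trans (sym (updateAt-updates s M)) M′s≡t)) t-blocked)
    heavier : ∀ u → E s u ≡ true → ∀ i → w i (M i) ≤ℚ w i (updateAt M s (const u) i)
    heavier u su∈E i with i ≟ s
    ... | yes refl = subst₂ (λ a b → w s a ≤ℚ w s b) (sym Ms≡t) (sym (updateAt-updates s M))
                       (t-lightest u su∈E)
    ... | no i≢s   = ℚ.≤-reflexive (cong (w i) (sym (updateAt-minimal i s M i≢s)))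

deleteEdge-true⇔ : ∀ {n m} (E : Graph n m) s t {i u} →
                   deleteEdge E s t i u ≡ true ⇔ (E i u ≡ true × (i ≡ s → u ≢ t))
deleteEdge-true⇔ E s t {i} {u} = mk⇔ to from
  where
  to : deleteEdge E s t i u ≡ true → E i u ≡ true × (i ≡ s → u ≢ t)
  to iu∈E′ with i ≟ s | u ≟ t
  to ()    | yes _   | yes _
  ... | yes _   | no u≢t = iu∈E′ , λ _ → u≢t
  ... | no i≢s  | _      = iu∈E′ , λ i≡s → contradiction i≡s i≢s
  from : E i u ≡ true × (i ≡ s → u ≢ t) → deleteEdge E s t i u ≡ true
  from (iu∈E , iu≢st) with i ≟ s | u ≟ t
  ... | yes i≡s | yes u≡t = contradiction u≡t (iu≢st i≡s)
  ... | yes _   | no _    = iu∈E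
  ... | no _    | _       = iu∈E

isPerfect-deleteEdge⇔ : ∀ {n m} (E : Graph n m) s t {d M} →
                        IsPerfectDMatching (deleteEdge E s t) d M ⇔
                        (IsPerfectDMatching E d M × M s ≢ t)
isPerfect-deleteEdge⇔ E s t {d} {M} = mk⇔ to from
  where
  ∈E′⇒ : ∀ {i u} → deleteEdge E s t i u ≡ true → E i u ≡ true × (i ≡ s → u ≢ t)
  ∈E′⇒ = Equivalence.to (deleteEdge-true⇔ E s t)
  ⇒∈E′ : ∀ {i u} → E i u ≡ true × (i ≡ s → u ≢ t) → deleteEdge E s t i u ≡ true
  ⇒∈E′ = Equivalence.from (deleteEdge-true⇔ E s t)
  to : IsPerfectDMatching (deleteEdge E s t) d M → IsPerfectDMatching E d M × M s ≢ t
  to (edges , distant) = ((λ i → proj₁ (∈E′⇒ (edges i))) , distant) , proj₂ (∈E′⇒ (edges s)) refl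
  from : IsPerfectDMatching E d M × M s ≢ t → IsPerfectDMatching (deleteEdge E s t) d M
  from ((edges , distant) , Ms≢t) = (λ i → ⇒∈E′ (edges i , λ { refl → Ms≢t })) , distant

deleteEdge-dominates : ∀ {n m} (E : Graph n m) r (w : Weight n m) {s t} →
                       IsMinEdgeAt E w s t → deg E s ≥ 2 * suc r →
                       ∀ {M} → IsPerfectDMatching E (suc r) M →
                       ∃ λ M′ → IsPerfectDMatching (deleteEdge E s t) (suc r) M′ ×
                                weightOf w M ≤ℚ weightOf w M′
deleteEdge-dominates E r w {s} {t} st-min deg≥ {M} M-perfect with M s ≟ t
... | no Ms≢t = M , Equivalence.from (isPerfect-deleteEdge⇔ E s t) (M-perfect , Ms≢t) , ℚ.≤-refl
... | yes Ms≡t =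
  let M′ , M′-perfect , M′s≢t , M≤M′ = reroute E w st-min deg≥ M-perfect Ms≡t
  in  M′ , Equivalence.from (isPerfect-deleteEdge⇔ E s t) (M′-perfect , M′s≢t) , M≤M′

module _ {n m} (E E′ : Graph n m) {d : ℕ} (w : Weight n m) where

  dominating-sub⇒IsMax⇔ :
    (∀ {M} → IsPerfectDMatching E′ d M → IsPerfectDMatching E d M) →
    (∀ {M} → IsPerfectDMatching E d M →
       ∃ λ M′ → IsPerfectDMatching E′ d M′ × weightOf w M ≤ℚ weightOf w M′) →
    ∀ v → IsMaxPerfectDWeight E d w v ⇔ IsMaxPerfectDWeight E′ d w v
  dominating-sub⇒IsMax⇔ E′⊆E dominates v = mk⇔ to from
    where
    to : IsMaxPerfectDWeight E d w v → IsMaxPerfectDWeight E′ d w v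
    to ((M , M-perfect , wM≡v) , ≤v) =
      let M′ , M′-perfect , M≤M′ = dominates M-perfect
      in  (M′ , M′-perfect , ℚ.≤-antisym (≤v _ (E′⊆E M′-perfect))
                                          (subst (_≤ℚ weightOf w M′) wM≡v M≤M′)) ,
          λ M″ → ≤v M″ ∘ E′⊆E
    from : IsMaxPerfectDWeight E′ d w v → IsMaxPerfectDWeight E d w v
    from ((M , M-perfect , wM≡v) , ≤v) =
      (M , E′⊆E M-perfect , wM≡v) ,
      λ M″ M″-perfect → let M′ , M′-perfect , M″≤M′ = dominates M″-perfect
                        in  ℚ.≤-trans M″≤M′ (≤v M′ M′-perfect)

claim1 : (n m : ℕ) (E : Graph n m) (d : ℕ) → 1 ≤ d →
    (w : Weight n m) → NonNegW E w →
    (s : Fin n) → deg E s ≥ 2 * d →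
    (t : Fin m) → IsMinEdgeAt E w s t →
    (v : ℚ) → IsMaxPerfectDWeight E d w v ⇔ IsMaxPerfectDWeight (deleteEdge E s t) d w v
claim1 n m E (suc r) (s≤s z≤n) w _ s deg≥ t st-min =
  dominating-sub⇒IsMax⇔ E (deleteEdge E s t) w
    (proj₁ ∘ Equivalence.to (isPerfect-deleteEdge⇔ E s t))
    (deleteEdge-dominates E r w st-min deg≥)
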